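{- In the setting described in the context, let $\rho_X\colon\Sigma(X+BX)\to TB\Sigma^{\star}X$ be a pre-De Simone law with operational model $\gamma$ and trace morphism $\mathsf{tr}$. Suppose the morphism $j_{1,1}\circ\langle\eta_1,\eta_1\rangle\colon 1\to T(1+1)$ is affine and every component $\rho_X$ is affine. Then $\gamma$ is affine, and $T!\circ\mathsf{tr}\sqsubseteq\eta_1\circ!$ in the partial order of the hom-set $\mathrm{Kl}(T)(\mu\Sigma,1)$.
   Context: Setting: $\mathcal{C}$ is a category with finite limits and finite coproducts; $\Sigma,B$ endofunctors and $(T,\eta,\mu)$ a monad on $\mathcal{C}$; $\Sigma$ has an initial algebra $(\mu\Sigma,\iota)$ and free algebras $\Sigma^{\star}X$ (free monad $\Sigma^{\star}$); $\hat\iota\colon\Sigma^{\star}(\mu\Sigma)\to\mu\Sigma$ is the unique $\Sigma$-algebra morphism extending $\mathrm{id}$. $\mathrm{Kl}(T)$: morphisms $X\rightsquigarrow Y$ are $\mathcal{C}$-morphisms $X\to TY$, $g\cdot f=\mu\circ Tg\circ f$, $Jf=\eta\circ f$. Assumptions: (1) a natural isomorphism $j_{X,Y}\colon TX\times TY\to T(X+Y)$; (2) distributive laws $\delta^{\Sigma}\colon\Sigma T\to T\Sigma$, $\delta^B\colon BT\to TB$ with Kleisli extensions $\bar\Sigma f=\delta^{\Sigma}\circ\Sigma f$, $\bar Bf=\delta^B\circ Bf$, and $\overline{\Sigma^{\star}}$ the induced Kleisli extension of $\Sigma^{\star}$; (3) $B$ has an initial algebra $(\mu B,\beta)$, each hom-set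 of $\mathrm{Kl}(T)$ is a DCPO with least element $\bot$, composition preserves directed joins in each argument and $\bot\cdot f=\bot$, and $\bar B$ is locally monotone; $(\mu B,J\beta^{ -1})$ is then a final $\bar B$-coalgebra. A pre-De Simone law is a natural transformation $\rho_X\colon\Sigma(X+BX)\to TB\Sigma^{\star}X$. Its operational model is the unique $\gamma\colon\mu\Sigma\to TB(\mu\Sigma)$ with $\gamma\cdot J\iota=\bar BJ\hat\iota\cdot\rho_{\mu\Sigma}\cdot\bar\Sigma(j\circ\langle\eta,\gamma\rangle)$ in $\mathrm{Kl}(T)$, and its trace morphism is the unique $\mathsf{tr}\colon\mu\Sigma\to T(\mu B)$ with $\mu\circ T(\delta^B\circ B\mathsf{tr})\circ\gamma=T\beta^{ -1}\circ\mathsf{tr}$. A morphism $p\colon P\to TX$ is affine if $T!\circ p=\eta_1\circ!_P$ (where $!$ denotes morphisms to the terminal object $1$). -}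

module Defs where

open import Level using (Level; _⊔_) renaming (suc to lsuc)
open import Relation.Binary.PropositionalEquality using (_≡_)
open import Data.Product using (Σ; _×_; _,_; ∃-syntax)

record Category (o h : Level) : Set (lsuc (o ⊔ h)) where
  infixr 9 _∘_
  field
    Obj : Set o
    Hom : Obj → Obj → Set h
    id  : ∀ {A} → Hom A A
    _∘_ : ∀ {A B C} → Hom B C → Hom A B → Hom A C
    identityˡ : ∀ {A B} {f : Hom A B} → id ∘ f ≡ f
    identityʳ : ∀ {A B} {f : Hom A B} → f ∘ id ≡ f
    assoc : ∀ {A B C D} {f : Hom A B} {g : Hom B C} {k : Hom C D} →
            (k ∘ g) ∘ f ≡ k ∘ (g ∘ f)

module _ {o h : Level} (C : Category o h) where
  open Category C

  record Endofunctor : Set (o ⊔ h) where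
    field
      F₀ : Obj → Obj
      F₁ : ∀ {A B} → Hom A B → Hom (F₀ A) (F₀ B)
      F-identity : ∀ {A} → F₁ (id {A}) ≡ id
      F-homomorphism : ∀ {A B D} {f : Hom A B} {g : Hom B D} →
                       F₁ (g ∘ f) ≡ F₁ g ∘ F₁ f

  record Monad : Set (o ⊔ h) where
    field
      T : Endofunctor
    open Endofunctor T
    field
      η : ∀ X → Hom X (F₀ X)
      μ : ∀ X → Hom (F₀ (F₀ X)) (F₀ X)
      η-natural : ∀ {X Y} (f : Hom X Y) → F₁ f ∘ η X ≡ η Y ∘ f
      μ-natural : ∀ {X Y} (f : Hom X Y) → F₁ f ∘ μ X ≡ μ Y ∘ F₁ (F₁ f)
      μ-assoc : ∀ {X} → μ X ∘ F₁ (μ X) ≡ μ X ∘ μ (F₀ X)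
      μ-identityˡ : ∀ {X} → μ X ∘ F₁ (η X) ≡ id
      μ-identityʳ : ∀ {X} → μ X ∘ η (F₀ X) ≡ id

  record FiniteLimits : Set (o ⊔ h) where
    infixr 7 _×ₒ_
    field
      ⊤ : Obj
      ! : ∀ A → Hom A ⊤
      !-unique : ∀ {A} (f : Hom A ⊤) → f ≡ ! A
      _×ₒ_ : Obj → Obj → Obj
      π₁ : ∀ {A B} → Hom (A ×ₒ B) A
      π₂ : ∀ {A B} → Hom (A ×ₒ B) B
      ⟨_,_⟩ : ∀ {X A B} → Hom X A → Hom X B → Hom X (A ×ₒ B)
      project₁ : ∀ {X A B} {f : Hom X A} {g : Hom X B} → π₁ ∘ ⟨ f , g ⟩ ≡ f
      project₂ : ∀ {X A B} {f : Hom X A} {g : Hom X B} → π₂ ∘ ⟨ f , g ⟩ ≡ g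
      ⟨⟩-unique : ∀ {X A B} {f : Hom X A} {g : Hom X B} (k : Hom X (A ×ₒ B)) →
                  π₁ ∘ k ≡ f → π₂ ∘ k ≡ g → k ≡ ⟨ f , g ⟩
      Eq : ∀ {A B} → Hom A B → Hom A B → Obj
      eq : ∀ {A B} (f g : Hom A B) → Hom (Eq f g) A
      eq-equalizes : ∀ {A B} (f g : Hom A B) → f ∘ eq f g ≡ g ∘ eq f g
      eq-factor : ∀ {A B X} (f g : Hom A B) (k : Hom X A) → f ∘ k ≡ g ∘ k → Hom X (Eq f g)
      eq-factor-eq : ∀ {A B X} (f g : Hom A B) (k : Hom X A) (p : f ∘ k ≡ g ∘ k) →
                     eq f g ∘ eq-factor f g k p ≡ k
      eq-factor-unique : ∀ {A B X} (f g : Hom A B) (k : Hom X A) (p : f ∘ k ≡ g ∘ k)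
                         (u : Hom X (Eq f g)) → eq f g ∘ u ≡ k → u ≡ eq-factor f g k p
    _⁂_ : ∀ {A B A' B'} → Hom A A' → Hom B B' → Hom (A ×ₒ B) (A' ×ₒ B')
    f ⁂ g = ⟨ f ∘ π₁ , g ∘ π₂ ⟩

  record FiniteCoproducts : Set (o ⊔ h) where
    infixr 6 _+ₒ_
    field
      𝟘 : Obj
      ¡ : ∀ A → Hom 𝟘 A
      ¡-unique : ∀ {A} (f : Hom 𝟘 A) → f ≡ ¡ A
      _+ₒ_ : Obj → Obj → Obj
      i₁ : ∀ {A B} → Hom A (A +ₒ B)
      i₂ : ∀ {A B} → Hom B (A +ₒ B)
      [_,_] : ∀ {A B X} → Hom A X → Hom B X → Hom (A +ₒ B) X
      inject₁ : ∀ {A B X} {f : Hom A X} {g : Hom B X} → [ f , g ] ∘ i₁ ≡ f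
      inject₂ : ∀ {A B X} {f : Hom A X} {g : Hom B X} → [ f , g ] ∘ i₂ ≡ g
      []-unique : ∀ {A B X} {f : Hom A X} {g : Hom B X} (k : Hom (A +ₒ B) X) →
                  k ∘ i₁ ≡ f → k ∘ i₂ ≡ g → k ≡ [ f , g ]
    _⊕_ : ∀ {A B A' B'} → Hom A A' → Hom B B' → Hom (A +ₒ B) (A' +ₒ B')
    f ⊕ g = [ i₁ ∘ f , i₂ ∘ g ]

  module _ (F : Endofunctor) where
    open Endofunctor F

    record InitialAlgebra : Set (o ⊔ h) where
      field
        carrier : Obj
        structure : Hom (F₀ carrier) carrier
        fold : ∀ (A : Obj) (a : Hom (F₀ A) A) → Hom carrier A
        fold-hom : ∀ A (a : Hom (F₀ A) A) → fold A a ∘ structure ≡ a ∘ F₁ (fold A a)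
        fold-unique : ∀ A (a : Hom (F₀ A) A) (k : Hom carrier A) →
                      k ∘ structure ≡ a ∘ F₁ k → k ≡ fold A a

    record FreeAlgebras : Set (o ⊔ h) where
      field
        free : Obj → Obj
        free-alg : ∀ X → Hom (F₀ (free X)) (free X)
        free-unit : ∀ X → Hom X (free X)
        ext : ∀ {X} (A : Obj) (a : Hom (F₀ A) A) (f : Hom X A) → Hom (free X) A
        ext-hom : ∀ {X} A (a : Hom (F₀ A) A) (f : Hom X A) →
                  ext A a f ∘ free-alg X ≡ a ∘ F₁ (ext A a f)
        ext-unit : ∀ {X} A (a : Hom (F₀ A) A) (f : Hom X A) → ext A a f ∘ free-unit X ≡ f
        ext-unique : ∀ {X} A (a : Hom (F₀ A) A) (f : Hom X A) (k : Hom (free X) A) →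
                     k ∘ free-alg X ≡ a ∘ F₁ k → k ∘ free-unit X ≡ f → k ≡ ext A a f
      free₁ : ∀ {X Y} → Hom X Y → Hom (free X) (free Y)
      free₁ {X} {Y} f = ext (free Y) (free-alg Y) (free-unit Y ∘ f)

  module _ (M : Monad) where
    open Monad M
    open Endofunctor T renaming (F₀ to T₀; F₁ to T₁)

    record DistributiveLaw (F : Endofunctor) : Set (o ⊔ h) where
      open Endofunctor F
      field
        δ : ∀ X → Hom (F₀ (T₀ X)) (T₀ (F₀ X))
        δ-natural : ∀ {X Y} (f : Hom X Y) → T₁ (F₁ f) ∘ δ X ≡ δ Y ∘ F₁ (T₁ f)
        δ-η : ∀ {X} → δ X ∘ F₁ (η X) ≡ η (F₀ X)
        δ-μ : ∀ {X} → δ X ∘ F₁ (μ X) ≡ μ (F₀ X) ∘ T₁ (δ X) ∘ δ (T₀ X)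
      bar : ∀ {X Y} → Hom X (T₀ Y) → Hom (F₀ X) (T₀ (F₀ Y))
      bar {Y = Y} f = δ Y ∘ F₁ f

    infixr 8 _·_
    _·_ : ∀ {X Y Z} → Hom Y (T₀ Z) → Hom X (T₀ Y) → Hom X (T₀ Z)
    _·_ {Z = Z} g f = μ Z ∘ T₁ g ∘ f

    -- DCPO-enrichment of Kl(T): every hom-set Kl(T)(X,Y) = Hom X (T Y) is a DCPO
    -- with least element ⊥; composition preserves directed joins in each argument
    -- and ⊥ · f = ⊥.
    record KleisliDCPO : Set (lsuc h ⊔ o) where
      infix 4 _⊑_
      field
        _⊑_ : ∀ {X Y} → Hom X (T₀ Y) → Hom X (T₀ Y) → Set h
        ⊑-refl : ∀ {X Y} {f : Hom X (T₀ Y)} → f ⊑ f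
        ⊑-trans : ∀ {X Y} {f g k : Hom X (T₀ Y)} → f ⊑ g → g ⊑ k → f ⊑ k
        ⊑-antisym : ∀ {X Y} {f g : Hom X (T₀ Y)} → f ⊑ g → g ⊑ f → f ≡ g
      Directed : ∀ {X Y} {I : Set h} → (I → Hom X (T₀ Y)) → Set h
      Directed {I = I} d = I × (∀ i j → ∃[ k ] (d i ⊑ d k × d j ⊑ d k))
      IsLub : ∀ {X Y} {I : Set h} → (I → Hom X (T₀ Y)) → Hom X (T₀ Y) → Set h
      IsLub {X} {Y} d x = (∀ i → d i ⊑ x) × (∀ (y : Hom X (T₀ Y)) → (∀ i → d i ⊑ y) → x ⊑ y)
      field
        ⊥ : ∀ {X Y} → Hom X (T₀ Y)
        ⊥-least : ∀ {X Y} (f : Hom X (T₀ Y)) → ⊥ ⊑ f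
        ⨆ : ∀ {X Y} {I : Set h} (d : I → Hom X (T₀ Y)) → Directed d → Hom X (T₀ Y)
        ⨆-lub : ∀ {X Y} {I : Set h} (d : I → Hom X (T₀ Y)) (dir : Directed d) → IsLub d (⨆ d dir)
        ·-continuousˡ : ∀ {X Y Z} {I : Set h} (g : Hom Y (T₀ Z)) (d : I → Hom X (T₀ Y))
                        (dir : Directed d) → IsLub (λ i → g · d i) (g · ⨆ d dir)
        ·-continuousʳ : ∀ {X Y Z} {I : Set h} (d : I → Hom Y (T₀ Z)) (f : Hom X (T₀ Y))
                        (dir : Directed d) → IsLub (λ i → d i · f) (⨆ d dir · f)
        ⊥-· : ∀ {X Y Z} (f : Hom X (T₀ Y)) → ⊥ {Y} {Z} · f ≡ ⊥

  module _ (lim : FiniteLimits) (cop : FiniteCoproducts) (M : Monad) where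
    open FiniteLimits lim
    open FiniteCoproducts cop
    open Monad M
    open Endofunctor T renaming (F₀ to T₀; F₁ to T₁)
    record ProductCoproductIso : Set (o ⊔ h) where
      field
        j : ∀ X Y → Hom (T₀ X ×ₒ T₀ Y) (T₀ (X +ₒ Y))
        j⁻¹ : ∀ X Y → Hom (T₀ (X +ₒ Y)) (T₀ X ×ₒ T₀ Y)
        j-iso₁ : ∀ {X Y} → j X Y ∘ j⁻¹ X Y ≡ id
        j-iso₂ : ∀ {X Y} → j⁻¹ X Y ∘ j X Y ≡ id
        j-natural : ∀ {X Y X' Y'} (f : Hom X X') (g : Hom Y Y') →
                    T₁ (f ⊕ g) ∘ j X Y ≡ j X' Y' ∘ (T₁ f ⁂ T₁ g)

record Setting (o h : Level) : Set (lsuc (o ⊔ h)) where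
  field
    C : Category o h
  open Category C public
  field
    lim : FiniteLimits C
    cop : FiniteCoproducts C
    Sig : Endofunctor C
    B : Endofunctor C
    M : Monad C
    Sig-init : InitialAlgebra C Sig
    Sig-free : FreeAlgebras C Sig
    jIso : ProductCoproductIso C lim cop M
    δΣ : DistributiveLaw C M Sig
    δB : DistributiveLaw C M B
    B-init : InitialAlgebra C B
    dcpo : KleisliDCPO C M
  open FiniteLimits lim public
  open FiniteCoproducts cop public
  open Monad M public hiding (T)
  open Endofunctor (Monad.T M) public renaming (F₀ to T₀; F₁ to T₁) hiding (F-identity; F-homomorphism)
  open Endofunctor Sig public renaming (F₀ to Σ₀; F₁ to Σ₁) hiding (F-identity; F-homomorphism)
  open Endofunctor B public renaming (F₀ to B₀; F₁ to B₁) hiding (F-identity; F-homomorphism)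
  open KleisliDCPO dcpo public
  open ProductCoproductIso jIso public
  infixr 8 _·ₖ_
  _·ₖ_ : ∀ {X Y Z} → Hom Y (T₀ Z) → Hom X (T₀ Y) → Hom X (T₀ Z)
  _·ₖ_ = _·_ C M
  J : ∀ {X Y} → Hom X Y → Hom X (T₀ Y)
  J {Y = Y} f = η Y ∘ f
  Σbar : ∀ {X Y} → Hom X (T₀ Y) → Hom (Σ₀ X) (T₀ (Σ₀ Y))
  Σbar = DistributiveLaw.bar δΣ
  Bbar : ∀ {X Y} → Hom X (T₀ Y) → Hom (B₀ X) (T₀ (B₀ Y))
  Bbar = DistributiveLaw.bar δB
  δᴮ : ∀ X → Hom (B₀ (T₀ X)) (T₀ (B₀ X))
  δᴮ = DistributiveLaw.δ δB
  field
    Bbar-monotone : ∀ {X Y} {f g : Hom X (T₀ Y)} → f ⊑ g → Bbar f ⊑ Bbar g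
  μΣ : Obj
  μΣ = InitialAlgebra.carrier Sig-init
  ι : Hom (Σ₀ μΣ) μΣ
  ι = InitialAlgebra.structure Sig-init
  Σ⋆₀ : Obj → Obj
  Σ⋆₀ = FreeAlgebras.free Sig-free
  Σ⋆₁ : ∀ {X Y} → Hom X Y → Hom (Σ⋆₀ X) (Σ⋆₀ Y)
  Σ⋆₁ = FreeAlgebras.free₁ Sig-free
  ι̂ : Hom (Σ⋆₀ μΣ) μΣ
  ι̂ = FreeAlgebras.ext Sig-free μΣ ι id
  -- initial B-algebra (μB, β) and β⁻¹ (Lambek)
  μB : Obj
  μB = InitialAlgebra.carrier B-init
  β : Hom (B₀ μB) μB
  β = InitialAlgebra.structure B-init
  β⁻¹ : Hom μB (B₀ μB)
  β⁻¹ = InitialAlgebra.fold B-init (B₀ μB) (B₁ β)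
  Affine : ∀ {P X} → Hom P (T₀ X) → Set h
  Affine {P} {X} p = T₁ (! X) ∘ p ≡ η ⊤ ∘ ! P

record PreDeSimoneLaw {o h : Level} (S : Setting o h) : Set (o ⊔ h) where
  open Setting S
  field
    ρ : ∀ X → Hom (Σ₀ (X +ₒ B₀ X)) (T₀ (B₀ (Σ⋆₀ X)))
    ρ-natural : ∀ {X Y} (f : Hom X Y) →
                T₁ (B₁ (Σ⋆₁ f)) ∘ ρ X ≡ ρ Y ∘ Σ₁ (f ⊕ B₁ f)

{-# OPTIONS --safe #-}
module Submission where

open import Defs
open import Data.Product using (_×_)
open import Relation.Binary.PropositionalEquality using (_≡_)
open import Level using (Lift; lift)
open import Data.Bool using (Bool; true; false)
open import Data.Product using (Σ-syntax; _,_; proj₁; proj₂)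
open import Relation.Binary.PropositionalEquality using (refl; sym; trans; cong; cong₂; subst; subst₂; module ≡-Reasoning)

-- The mass T! ∘ γ of the operational model and the constant η ∘ ! are both Σ-algebra morphisms
-- from (μΣ, ι) into one algebra on T1: as ρ and j ∘ ⟨ η , η ⟩ are affine, the mass of a step
-- depends only on the masses of its arguments. By initiality they agree, so γ is affine.
-- For the trace, the property "x · tr is sub-affine" holds for ⊥, survives directed joins and,
-- by the trace equation, monotonicity of B̄ and affineness of γ, is preserved by
-- Ψ x = Jβ · B̄x · Jβ⁻¹. Pataraia's theorem yields a fixpoint of Ψ with the property, and
-- initiality of (μB, β) forces that fixpoint to be η.

module CategoryProperties {o h} (C : Category o h) where
  open Category C

  pullˡ : ∀ {A B D E} {f : Hom A B} {g : Hom B D} {k : Hom D E} {l : Hom B E} →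
          k ∘ g ≡ l → k ∘ g ∘ f ≡ l ∘ f
  pullˡ {f = f} kg≡l = trans (sym assoc) (cong (_∘ f) kg≡l)

module FiniteLimitsProperties {o h} {C : Category o h} (lim : FiniteLimits C) where
  open Category C
  open FiniteLimits lim

  !-unique₂ : ∀ {A} (f g : Hom A ⊤) → f ≡ g
  !-unique₂ f g = trans (!-unique f) (sym (!-unique g))

  ⟨⟩∘ : ∀ {X Y A B} {f : Hom Y A} {g : Hom Y B} (k : Hom X Y) →
        ⟨ f , g ⟩ ∘ k ≡ ⟨ f ∘ k , g ∘ k ⟩
  ⟨⟩∘ k = ⟨⟩-unique _ (trans (sym assoc) (cong (_∘ k) project₁))
                      (trans (sym assoc) (cong (_∘ k) project₂))

  ⁂∘⟨⟩ : ∀ {X A B A' B'} (f : Hom A A') (g : Hom B B') (a : Hom X A) (b : Hom X B) →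
         (f ⁂ g) ∘ ⟨ a , b ⟩ ≡ ⟨ f ∘ a , g ∘ b ⟩
  ⁂∘⟨⟩ f g a b = trans (⟨⟩∘ ⟨ a , b ⟩)
    (cong₂ ⟨_,_⟩ (trans assoc (cong (f ∘_) project₁)) (trans assoc (cong (g ∘_) project₂)))

module InitialAlgebraProperties {o h} {C : Category o h} {F : Endofunctor C}
                                (A : InitialAlgebra C F) where
  open Category C
  open Endofunctor F
  open InitialAlgebra A

  algebra-morphisms-unique : ∀ {X} (a : Hom (F₀ X) X) {f g : Hom carrier X} →
    f ∘ structure ≡ a ∘ F₁ f → g ∘ structure ≡ a ∘ F₁ g → f ≡ g
  algebra-morphisms-unique a {f} {g} f-hom g-hom =
    trans (fold-unique _ a f f-hom) (sym (fold-unique _ a g g-hom))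

  structure⁻¹ : Hom carrier (F₀ carrier)
  structure⁻¹ = fold (F₀ carrier) (F₁ structure)

  structure∘structure⁻¹ : structure ∘ structure⁻¹ ≡ id
  structure∘structure⁻¹ = algebra-morphisms-unique structure
    (trans assoc (trans (cong (structure ∘_) (fold-hom _ _)) (cong (structure ∘_) (sym F-homomorphism))))
    (trans identityˡ (trans (sym identityʳ) (cong (structure ∘_) (sym F-identity))))

  structure⁻¹∘structure : structure⁻¹ ∘ structure ≡ id
  structure⁻¹∘structure =
    trans (fold-hom _ _) (trans (sym F-homomorphism) (trans (cong F₁ structure∘structure⁻¹) F-identity))

module KleisliNotation {o h} {C : Category o h} (M : Monad C) where
  open Category C
  open Endofunctor (Monad.T M) renaming (F₀ to T₀)

  infixr 8 _·ₖ_
  _·ₖ_ : ∀ {X Y Z} → Hom Y (T₀ Z) → Hom X (T₀ Y) → Hom X (T₀ Z)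
  _·ₖ_ = _·_ C M

module KleisliProperties {o h} {C : Category o h} (M : Monad C) where
  open Category C
  open KleisliNotation M
  open CategoryProperties C
  open Monad M hiding (T)
  open Endofunctor (Monad.T M) renaming (F₀ to T₀; F₁ to T₁; F-homomorphism to T-homomorphism)
  open ≡-Reasoning

  T₁∘· : ∀ {X Y Z W} (f : Hom Z W) (g : Hom Y (T₀ Z)) (k : Hom X (T₀ Y)) →
         T₁ f ∘ (g ·ₖ k) ≡ (T₁ f ∘ g) ·ₖ k
  T₁∘· {Z = Z} {W} f g k = begin
    T₁ f ∘ μ Z ∘ T₁ g ∘ k          ≡⟨ pullˡ (μ-natural f) ⟩
    (μ W ∘ T₁ (T₁ f)) ∘ T₁ g ∘ k   ≡⟨ assoc ⟩
    μ W ∘ T₁ (T₁ f) ∘ T₁ g ∘ k     ≡⟨ cong (μ W ∘_) (pullˡ (sym T-homomorphism)) ⟩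
    μ W ∘ T₁ (T₁ f ∘ g) ∘ k        ∎

  η∘-· : ∀ {X Y Z} (f : Hom Y Z) (k : Hom X (T₀ Y)) → (η Z ∘ f) ·ₖ k ≡ T₁ f ∘ k
  η∘-· {Z = Z} f k = begin
    μ Z ∘ T₁ (η Z ∘ f) ∘ k         ≡⟨ cong (λ t → μ Z ∘ t ∘ k) T-homomorphism ⟩
    μ Z ∘ (T₁ (η Z) ∘ T₁ f) ∘ k    ≡⟨ cong (μ Z ∘_) assoc ⟩
    μ Z ∘ T₁ (η Z) ∘ T₁ f ∘ k      ≡⟨ pullˡ μ-identityˡ ⟩
    id ∘ T₁ f ∘ k                  ≡⟨ identityˡ ⟩
    T₁ f ∘ k                       ∎

  ·-η∘ : ∀ {X Y Z} (g : Hom Y (T₀ Z)) (f : Hom X Y) → g ·ₖ (η Y ∘ f) ≡ g ∘ f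
  ·-η∘ {Y = Y} {Z} g f = begin
    μ Z ∘ T₁ g ∘ η Y ∘ f           ≡⟨ cong (μ Z ∘_) (pullˡ (η-natural g)) ⟩
    μ Z ∘ (η (T₀ Z) ∘ g) ∘ f       ≡⟨ cong (μ Z ∘_) assoc ⟩
    μ Z ∘ η (T₀ Z) ∘ g ∘ f         ≡⟨ pullˡ μ-identityʳ ⟩
    id ∘ g ∘ f                     ≡⟨ identityˡ ⟩
    g ∘ f                          ∎

  ·-identityˡ : ∀ {X Y} (k : Hom X (T₀ Y)) → η Y ·ₖ k ≡ k
  ·-identityˡ k = trans (pullˡ μ-identityˡ) identityˡ

  ·-assoc : ∀ {X Y Z W} (k : Hom Z (T₀ W)) (g : Hom Y (T₀ Z)) (f : Hom X (T₀ Y)) →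
            (k ·ₖ g) ·ₖ f ≡ k ·ₖ (g ·ₖ f)
  ·-assoc {Z = Z} {W} k g f = begin
    μ W ∘ T₁ (μ W ∘ T₁ k ∘ g) ∘ f              ≡⟨ cong (λ t → μ W ∘ t ∘ f)
                                                     (trans T-homomorphism (cong (T₁ (μ W) ∘_) T-homomorphism)) ⟩
    μ W ∘ (T₁ (μ W) ∘ T₁ (T₁ k) ∘ T₁ g) ∘ f    ≡⟨ cong (μ W ∘_) (trans assoc (cong (T₁ (μ W) ∘_) assoc)) ⟩
    μ W ∘ T₁ (μ W) ∘ T₁ (T₁ k) ∘ T₁ g ∘ f      ≡⟨ pullˡ μ-assoc ⟩
    (μ W ∘ μ (T₀ W)) ∘ T₁ (T₁ k) ∘ T₁ g ∘ f    ≡⟨ assoc ⟩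
    μ W ∘ μ (T₀ W) ∘ T₁ (T₁ k) ∘ T₁ g ∘ f      ≡⟨ cong (μ W ∘_) (pullˡ (sym (μ-natural k))) ⟩
    μ W ∘ (T₁ k ∘ μ Z) ∘ T₁ g ∘ f              ≡⟨ cong (μ W ∘_) assoc ⟩
    μ W ∘ T₁ k ∘ μ Z ∘ T₁ g ∘ f                ∎

module DistributiveLawProperties {o h} {C : Category o h} {M : Monad C} {F : Endofunctor C}
                                 (law : DistributiveLaw C M F) where
  open Category C
  open CategoryProperties C
  open Monad M hiding (T)
  open Endofunctor (Monad.T M) renaming (F₀ to T₀; F₁ to T₁; F-homomorphism to T-homomorphism)
  open Endofunctor F
  open DistributiveLaw law
  open KleisliNotation M
  open ≡-Reasoning

  bar-η∘ : ∀ {X Y} (f : Hom X Y) → bar (η Y ∘ f) ≡ η (F₀ Y) ∘ F₁ f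
  bar-η∘ f = trans (cong (δ _ ∘_) F-homomorphism) (pullˡ δ-η)

  bar-∘ : ∀ {X Y Z} (q : Hom Y (T₀ Z)) (f : Hom X Y) → bar (q ∘ f) ≡ bar q ∘ F₁ f
  bar-∘ q f = trans (cong (δ _ ∘_) F-homomorphism) (sym assoc)

  T₁F₁∘bar : ∀ {X Y Y'} (f : Hom Y Y') (q : Hom X (T₀ Y)) → T₁ (F₁ f) ∘ bar q ≡ bar (T₁ f ∘ q)
  T₁F₁∘bar {Y' = Y'} f q =
    trans (pullˡ (δ-natural f)) (trans assoc (cong (δ Y' ∘_) (sym F-homomorphism)))

  bar-· : ∀ {X Y Z} (g : Hom Y (T₀ Z)) (f : Hom X (T₀ Y)) → bar (g ·ₖ f) ≡ bar g ·ₖ bar f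
  bar-· {Y = Y} {Z} g f = begin
    δ Z ∘ F₁ (μ Z ∘ T₁ g ∘ f)                             ≡⟨ cong (δ Z ∘_)
                                                               (trans F-homomorphism (cong (F₁ (μ Z) ∘_) F-homomorphism)) ⟩
    δ Z ∘ F₁ (μ Z) ∘ F₁ (T₁ g) ∘ F₁ f                     ≡⟨ pullˡ δ-μ ⟩
    (μ (F₀ Z) ∘ T₁ (δ Z) ∘ δ (T₀ Z)) ∘ F₁ (T₁ g) ∘ F₁ f   ≡⟨ trans assoc (cong (μ (F₀ Z) ∘_) assoc) ⟩
    μ (F₀ Z) ∘ T₁ (δ Z) ∘ δ (T₀ Z) ∘ F₁ (T₁ g) ∘ F₁ f     ≡⟨ cong (λ t → μ (F₀ Z) ∘ T₁ (δ Z) ∘ t)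
                                                               (pullˡ (sym (δ-natural g))) ⟩
    μ (F₀ Z) ∘ T₁ (δ Z) ∘ (T₁ (F₁ g) ∘ δ Y) ∘ F₁ f        ≡⟨ cong (μ (F₀ Z) ∘_)
                                                               (trans (cong (T₁ (δ Z) ∘_) assoc) (pullˡ (sym T-homomorphism))) ⟩
    μ (F₀ Z) ∘ T₁ (δ Z ∘ F₁ g) ∘ δ Y ∘ F₁ f               ∎

module KleisliDCPOProperties {o h} {C : Category o h} {M : Monad C} (D : KleisliDCPO C M) where
  open Category C
  open Monad M hiding (T)
  open Endofunctor (Monad.T M) renaming (F₀ to T₀; F₁ to T₁)
  open KleisliDCPO D
  open KleisliNotation M
  open KleisliProperties M

  lub-unique : ∀ {X Y} {I : Set h} {d : I → Hom X (T₀ Y)} {x y : Hom X (T₀ Y)} →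
               IsLub d x → IsLub d y → x ≡ y
  lub-unique (x-ub , x-least) (y-ub , y-least) = ⊑-antisym (x-least _ y-ub) (y-least _ x-ub)

  ⊑-respˡ-≡ : ∀ {X Y} {f g k : Hom X (T₀ Y)} → f ≡ g → f ⊑ k → g ⊑ k
  ⊑-respˡ-≡ refl f⊑k = f⊑k

  two-chain : ∀ {X Y} → Hom X (T₀ Y) → Hom X (T₀ Y) → Lift h Bool → Hom X (T₀ Y)
  two-chain f g (lift false) = f
  two-chain f g (lift true)  = g

  two-chain-lub : ∀ {X Y} {f g : Hom X (T₀ Y)} → f ⊑ g → IsLub (two-chain f g) g
  two-chain-lub {f = f} {g} f⊑g = below-g , λ _ ub → ub (lift true)
    where
    below-g : ∀ i → two-chain f g i ⊑ g
    below-g (lift false) = f⊑g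
    below-g (lift true)  = ⊑-refl

  two-chain-directed : ∀ {X Y} {f g : Hom X (T₀ Y)} → f ⊑ g → Directed (two-chain f g)
  two-chain-directed f⊑g =
    lift true , λ i i' → lift true , proj₁ (two-chain-lub f⊑g) i , proj₁ (two-chain-lub f⊑g) i'

  ⨆-two-chain : ∀ {X Y} {f g : Hom X (T₀ Y)} (f⊑g : f ⊑ g) → ⨆ (two-chain f g) (two-chain-directed f⊑g) ≡ g
  ⨆-two-chain f⊑g = lub-unique (⨆-lub _ (two-chain-directed f⊑g)) (two-chain-lub f⊑g)

  ·-monoʳ : ∀ {X Y Z} (k : Hom Y (T₀ Z)) {f g : Hom X (T₀ Y)} → f ⊑ g → k ·ₖ f ⊑ k ·ₖ g
  ·-monoʳ k {f} {g} f⊑g = subst (λ x → k ·ₖ f ⊑ k ·ₖ x) (⨆-two-chain f⊑g)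
    (proj₁ (·-continuousˡ k (two-chain f g) (two-chain-directed f⊑g)) (lift false))

  ·-monoˡ : ∀ {X Y Z} (k : Hom X (T₀ Y)) {f g : Hom Y (T₀ Z)} → f ⊑ g → f ·ₖ k ⊑ g ·ₖ k
  ·-monoˡ k {f} {g} f⊑g = subst (λ x → f ·ₖ k ⊑ x ·ₖ k) (⨆-two-chain f⊑g)
    (proj₁ (·-continuousʳ (two-chain f g) k (two-chain-directed f⊑g)) (lift false))

  T₁∘-monotone : ∀ {X Y Z} (k : Hom Y Z) {f g : Hom X (T₀ Y)} → f ⊑ g → T₁ k ∘ f ⊑ T₁ k ∘ g
  T₁∘-monotone k {f} {g} f⊑g = subst₂ _⊑_ (η∘-· k f) (η∘-· k g) (·-monoʳ (η _ ∘ k) f⊑g)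

  ·-directedʳ : ∀ {X Y Z} {I : Set h} {d : I → Hom Y (T₀ Z)} (f : Hom X (T₀ Y)) →
                Directed d → Directed (λ i → d i ·ₖ f)
  ·-directedʳ f (i₀ , bound) = i₀ , λ i i' →
    let (k , i⊑k , i'⊑k) = bound i i' in k , ·-monoˡ f i⊑k , ·-monoˡ f i'⊑k

  ⨆-·ʳ : ∀ {X Y Z} {I : Set h} (d : I → Hom Y (T₀ Z)) (f : Hom X (T₀ Y)) (dir : Directed d) →
         ⨆ d dir ·ₖ f ≡ ⨆ (λ i → d i ·ₖ f) (·-directedʳ f dir)
  ⨆-·ʳ d f dir = lub-unique (·-continuousʳ d f dir) (⨆-lub _ (·-directedʳ f dir))

  -- ⊥ = ⊥ · ⊥ factors through the initial object 𝟘, and any two maps out of 𝟘 agree.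
  ·-⊥ : FiniteCoproducts C → ∀ {X Y Z} (g : Hom Y (T₀ Z)) → g ·ₖ ⊥ {X} {Y} ≡ ⊥
  ·-⊥ cop {X} {Y} {Z} g = begin
    g ·ₖ ⊥                 ≡⟨ cong (g ·ₖ_) (sym (⊥-· ⊥)) ⟩
    g ·ₖ (⊥ {𝟘} ·ₖ ⊥)      ≡⟨ sym (·-assoc g ⊥ ⊥) ⟩
    (g ·ₖ ⊥ {𝟘}) ·ₖ ⊥      ≡⟨ cong (_·ₖ ⊥) (trans (¡-unique _) (sym (¡-unique _))) ⟩
    ⊥ {𝟘} {Z} ·ₖ ⊥         ≡⟨ ⊥-· ⊥ ⟩
    ⊥                      ∎
    where
    open FiniteCoproducts cop
    open ≡-Reasoning

  -- Pataraia's theorem, relativised to an admissible predicate P: the monotone inflationary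
  -- maps on admissible post-fixpoints form a directed family whose pointwise join absorbs Φ.
  module Pataraia {X Y} (Φ : Hom X (T₀ Y) → Hom X (T₀ Y))
                  (Φ-monotone : ∀ {a b} → a ⊑ b → Φ a ⊑ Φ b)
                  (P : Hom X (T₀ Y) → Set h) (P-⊥ : P ⊥) (P-Φ : ∀ {a} → P a → P (Φ a))
                  (P-⨆ : ∀ {I : Set h} (d : I → Hom X (T₀ Y)) (dir : Directed d) →
                         (∀ i → P (d i)) → P (⨆ d dir)) where

    record PostFixpoint : Set h where
      field
        point : Hom X (T₀ Y)
        admissible : P point
        post : point ⊑ Φ point
    open PostFixpoint

    record Progressive : Set h where
      field
        apply : PostFixpoint → PostFixpoint
        monotone : ∀ a b → point a ⊑ point b → point (apply a) ⊑ point (apply b)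
        inflationary : ∀ a → point a ⊑ point (apply a)
    open Progressive

    identity : Progressive
    apply identity a = a
    monotone identity _ _ a⊑b = a⊑b
    inflationary identity _ = ⊑-refl

    _⊚_ : Progressive → Progressive → Progressive
    apply (m ⊚ n) a = apply m (apply n a)
    monotone (m ⊚ n) a b a⊑b = monotone m _ _ (monotone n a b a⊑b)
    inflationary (m ⊚ n) a = ⊑-trans (inflationary n a) (inflationary m (apply n a))

    Φ-step : Progressive
    point (apply Φ-step a) = Φ (point a)
    admissible (apply Φ-step a) = P-Φ (admissible a)
    post (apply Φ-step a) = Φ-monotone (post a)
    monotone Φ-step _ _ = Φ-monotone
    inflationary Φ-step = post

    orbit : PostFixpoint → Progressive → Hom X (T₀ Y)
    orbit a m = point (apply m a)

    orbit-directed : ∀ a → Directed (orbit a)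
    orbit-directed a = identity , λ m n →
      m ⊚ n , monotone m _ _ (inflationary n a) , inflationary m (apply n a)

    orbit-below : ∀ a m → orbit a m ⊑ ⨆ (orbit a) (orbit-directed a)
    orbit-below a = proj₁ (⨆-lub (orbit a) (orbit-directed a))

    orbit-least : ∀ a {y} → (∀ m → orbit a m ⊑ y) → ⨆ (orbit a) (orbit-directed a) ⊑ y
    orbit-least a = proj₂ (⨆-lub (orbit a) (orbit-directed a)) _

    top : Progressive
    point (apply top a) = ⨆ (orbit a) (orbit-directed a)
    admissible (apply top a) = P-⨆ (orbit a) (orbit-directed a) (λ m → admissible (apply m a))
    post (apply top a) = orbit-least a (λ m → ⊑-trans (post (apply m a)) (Φ-monotone (orbit-below a m)))
    monotone top a b a⊑b = orbit-least a (λ m → ⊑-trans (monotone m a b a⊑b) (orbit-below b m))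
    inflationary top a = orbit-below a identity

    fixpoint : Σ[ a ∈ Hom X (T₀ Y) ] (P a × Φ a ≡ a)
    fixpoint = point z , admissible z , ⊑-antisym (orbit-below bottom (Φ-step ⊚ top)) (post z)
      where
      bottom : PostFixpoint
      bottom = record { point = ⊥ ; admissible = P-⊥ ; post = ⊥-least _ }
      z : PostFixpoint
      z = apply top bottom

module SettingProperties {o h} (S : Setting o h) where
  open Setting S
  open Endofunctor (Monad.T M) using () renaming (F-homomorphism to T-homomorphism)
  open CategoryProperties C
  open FiniteLimitsProperties lim
  open KleisliProperties M
  open KleisliDCPOProperties dcpo
  open ≡-Reasoning

  private
    module B-initial = InitialAlgebraProperties B-init

  mass : ∀ {P X} → Hom P (T₀ X) → Hom P (T₀ ⊤)
  mass {X = X} p = T₁ (! X) ∘ p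

  SubAffine : ∀ {P X} → Hom P (T₀ X) → Set h
  SubAffine {P} p = mass p ⊑ η ⊤ ∘ ! P

  η!∘ : ∀ {P Q} (f : Hom Q P) → (η ⊤ ∘ ! P) ∘ f ≡ η ⊤ ∘ ! Q
  η!∘ f = trans assoc (cong (η ⊤ ∘_) (!-unique₂ _ _))

  mass-T₁ : ∀ {P X Y} (f : Hom X Y) (p : Hom P (T₀ X)) → mass (T₁ f ∘ p) ≡ mass p
  mass-T₁ f p = trans (pullˡ (sym T-homomorphism)) (cong (λ t → T₁ t ∘ p) (!-unique₂ _ _))

  mass-affine-· : ∀ {P X Y} {p : Hom X (T₀ Y)} → Affine p → (q : Hom P (T₀ X)) → mass (p ·ₖ q) ≡ mass q
  mass-affine-· {p = p} p-affine q = begin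
    mass (p ·ₖ q)    ≡⟨ T₁∘· (! _) p q ⟩
    mass p ·ₖ q      ≡⟨ cong (_·ₖ q) p-affine ⟩
    J (! _) ·ₖ q     ≡⟨ η∘-· (! _) q ⟩
    mass q           ∎

  Affine-J : ∀ {P X} (f : Hom P X) → Affine (J f)
  Affine-J {X = X} f = trans (pullˡ (η-natural (! X))) (η!∘ f)

  Affine-∘ : ∀ {P Q X} {p : Hom P (T₀ X)} → Affine p → (f : Hom Q P) → Affine (p ∘ f)
  Affine-∘ p-affine f = trans (sym assoc) (trans (cong (_∘ f) p-affine) (η!∘ f))

  module _ {F : Endofunctor C} (law : DistributiveLaw C M F) where
    open Endofunctor F
    open DistributiveLaw law using (bar)
    open DistributiveLawProperties law

    mass-bar-T₁ : ∀ {Z Y Y'} (f : Hom Y Y') (q : Hom Z (T₀ Y)) → mass (bar (T₁ f ∘ q)) ≡ mass (bar q)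
    mass-bar-T₁ f q = trans (cong mass (sym (T₁F₁∘bar f q))) (mass-T₁ (F₁ f) (bar q))

    mass-bar-· : ∀ {Z W V} (y : Hom W (T₀ V)) (g : Hom Z (T₀ (F₀ W))) →
                 mass (bar y ·ₖ g) ≡ mass (bar (mass y) ·ₖ g)
    mass-bar-· y g = begin
      mass (bar y ·ₖ g)                     ≡⟨ sym (mass-T₁ (F₁ (! _)) _) ⟩
      mass (T₁ (F₁ (! _)) ∘ (bar y ·ₖ g))   ≡⟨ cong mass (T₁∘· _ _ _) ⟩
      mass ((T₁ (F₁ (! _)) ∘ bar y) ·ₖ g)   ≡⟨ cong (λ t → mass (t ·ₖ g)) (T₁F₁∘bar (! _) y) ⟩
      mass (bar (mass y) ·ₖ g)              ∎

    Affine-bar : ∀ {Z Y} {q : Hom Z (T₀ Y)} → Affine q → Affine (bar q)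
    Affine-bar {q = q} q-affine = begin
      mass (bar q)                  ≡⟨ sym (mass-bar-T₁ (! _) q) ⟩
      mass (bar (mass q))           ≡⟨ cong (λ t → mass (bar t)) q-affine ⟩
      mass (bar (η ⊤ ∘ ! _))        ≡⟨ cong mass (bar-η∘ (! _)) ⟩
      mass (η (F₀ ⊤) ∘ F₁ (! _))    ≡⟨ Affine-J (F₁ (! _)) ⟩
      η ⊤ ∘ ! _                     ∎

  SubAffine-affine-· : ∀ {P X Y} {p : Hom X (T₀ Y)} {q : Hom P (T₀ X)} →
                       Affine p → SubAffine q → SubAffine (p ·ₖ q)
  SubAffine-affine-· {q = q} p-affine = ⊑-respˡ-≡ (sym (mass-affine-· p-affine q))

  SubAffine-Bbar-· : ∀ {Z W V} {y : Hom W (T₀ V)} {g : Hom Z (T₀ (B₀ W))} →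
                     SubAffine y → Affine g → SubAffine (Bbar y ·ₖ g)
  SubAffine-Bbar-· {y = y} {g} y-subaffine g-affine =
    subst₂ _⊑_ (sym (mass-bar-· δB y g)) (trans (mass-affine-· (Affine-bar δB (Affine-J _)) g) g-affine)
      (T₁∘-monotone (! _) (·-monoˡ g (Bbar-monotone y-subaffine)))

  SubAffine-⊥ : ∀ {P X} → SubAffine (⊥ {P} {X})
  SubAffine-⊥ = ⊑-respˡ-≡ (trans (sym (·-⊥ cop (J (! _)))) (η∘-· (! _) ⊥)) (⊥-least _)

  SubAffine-⨆ : ∀ {P X} {I : Set h} (d : I → Hom P (T₀ X)) (dir : Directed d) →
                (∀ i → SubAffine (d i)) → SubAffine (⨆ d dir)
  SubAffine-⨆ d dir d-subaffine = ⊑-respˡ-≡ (η∘-· (! _) (⨆ d dir))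
    (proj₂ (·-continuousˡ (J (! _)) d dir) _
      (λ i → ⊑-respˡ-≡ (sym (η∘-· (! _) (d i))) (d-subaffine i)))

  -- The fixpoints of Ψ are the Kleisli endomorphisms of the final B̄-coalgebra (μB, Jβ⁻¹).
  Ψ : Hom μB (T₀ μB) → Hom μB (T₀ μB)
  Ψ x = J β ·ₖ Bbar x ·ₖ J β⁻¹

  Ψ-monotone : ∀ {x y} → x ⊑ y → Ψ x ⊑ Ψ y
  Ψ-monotone x⊑y = ·-monoʳ (J β) (·-monoˡ (J β⁻¹) (Bbar-monotone x⊑y))

  Ψ-fixpoint-unique : ∀ x → Ψ x ≡ x → x ≡ η μB
  Ψ-fixpoint-unique x Ψx≡x = B-initial.algebra-morphisms-unique (T₁ β ∘ δᴮ μB) x-hom η-hom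
    where
    x-hom : x ∘ β ≡ (T₁ β ∘ δᴮ μB) ∘ B₁ x
    x-hom = begin
      x ∘ β                    ≡⟨ cong (_∘ β) (sym Ψx≡x) ⟩
      Ψ x ∘ β                  ≡⟨ cong (_∘ β) (trans (η∘-· β _) (cong (T₁ β ∘_) (·-η∘ (Bbar x) β⁻¹))) ⟩
      (T₁ β ∘ Bbar x ∘ β⁻¹) ∘ β ≡⟨ trans assoc (cong (T₁ β ∘_) (trans assoc (cong (Bbar x ∘_) B-initial.structure⁻¹∘structure))) ⟩
      T₁ β ∘ Bbar x ∘ id       ≡⟨ cong (T₁ β ∘_) identityʳ ⟩
      T₁ β ∘ δᴮ μB ∘ B₁ x      ≡⟨ sym assoc ⟩
      (T₁ β ∘ δᴮ μB) ∘ B₁ x    ∎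
    η-hom : η μB ∘ β ≡ (T₁ β ∘ δᴮ μB) ∘ B₁ (η μB)
    η-hom = begin
      η μB ∘ β                    ≡⟨ sym (η-natural β) ⟩
      T₁ β ∘ η (B₀ μB)            ≡⟨ cong (T₁ β ∘_) (sym (DistributiveLaw.δ-η δB)) ⟩
      T₁ β ∘ δᴮ μB ∘ B₁ (η μB)    ≡⟨ sym assoc ⟩
      (T₁ β ∘ δᴮ μB) ∘ B₁ (η μB)  ∎

module OperationalModel {o h} (S : Setting o h) (L : PreDeSimoneLaw S) where
  open Setting S
  open PreDeSimoneLaw L
  open CategoryProperties C
  open FiniteLimitsProperties lim
  open KleisliProperties M
  open KleisliDCPOProperties dcpo
  open SettingProperties S
  module Σ-law = DistributiveLawProperties δΣ
  module B-law = DistributiveLawProperties δB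
  module Σ-initial = InitialAlgebraProperties Sig-init
  open ≡-Reasoning

  -- Since η is affine, only the mass of the BX-component of j ∘ ⟨ η , g ⟩ carries information.
  ⊤-split : Hom (T₀ ⊤) (T₀ (⊤ +ₒ ⊤))
  ⊤-split = j ⊤ ⊤ ∘ ⟨ η ⊤ ∘ ! (T₀ ⊤) , id ⟩

  mass-algebra : Hom (Σ₀ (T₀ ⊤)) (T₀ ⊤)
  mass-algebra = mass (Σbar ⊤-split)

  mass-algebra∘Σ₁ : ∀ {X} (q : Hom X (T₀ ⊤)) → mass-algebra ∘ Σ₁ q ≡ mass (Σbar (⊤-split ∘ q))
  mass-algebra∘Σ₁ q = trans assoc (cong mass (sym (Σ-law.bar-∘ ⊤-split q)))

  T₁!⊕!∘j∘⟨η,g⟩ : ∀ {X Y} (g : Hom X (T₀ Y)) →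
                  T₁ (! X ⊕ ! Y) ∘ j X Y ∘ ⟨ η X , g ⟩ ≡ ⊤-split ∘ mass g
  T₁!⊕!∘j∘⟨η,g⟩ {X} {Y} g = begin
    T₁ (! X ⊕ ! Y) ∘ j X Y ∘ ⟨ η X , g ⟩              ≡⟨ pullˡ (j-natural (! X) (! Y)) ⟩
    (j ⊤ ⊤ ∘ (T₁ (! X) ⁂ T₁ (! Y))) ∘ ⟨ η X , g ⟩     ≡⟨ trans assoc (cong (j ⊤ ⊤ ∘_) (⁂∘⟨⟩ _ _ _ _)) ⟩
    j ⊤ ⊤ ∘ ⟨ T₁ (! X) ∘ η X , mass g ⟩               ≡⟨ cong (λ t → j ⊤ ⊤ ∘ ⟨ t , mass g ⟩)
                                                           (trans (η-natural (! X)) (sym (η!∘ (mass g)))) ⟩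
    j ⊤ ⊤ ∘ ⟨ (η ⊤ ∘ ! (T₀ ⊤)) ∘ mass g , mass g ⟩    ≡⟨ cong (λ t → j ⊤ ⊤ ∘ ⟨ (η ⊤ ∘ ! (T₀ ⊤)) ∘ mass g , t ⟩)
                                                           (sym identityˡ) ⟩
    j ⊤ ⊤ ∘ ⟨ (η ⊤ ∘ ! (T₀ ⊤)) ∘ mass g , id ∘ mass g ⟩ ≡⟨ cong (j ⊤ ⊤ ∘_) (sym (⟨⟩∘ (mass g))) ⟩
    j ⊤ ⊤ ∘ ⟨ η ⊤ ∘ ! (T₀ ⊤) , id ⟩ ∘ mass g          ≡⟨ sym assoc ⟩
    ⊤-split ∘ mass g                                  ∎

  ⊤-split∘η : ⊤-split ∘ η ⊤ ≡ j ⊤ ⊤ ∘ ⟨ η ⊤ , η ⊤ ⟩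
  ⊤-split∘η = trans assoc (cong (j ⊤ ⊤ ∘_) (trans (⟨⟩∘ (η ⊤)) (cong₂ ⟨_,_⟩ η!∘η identityˡ)))
    where
    η!∘η : (η ⊤ ∘ ! (T₀ ⊤)) ∘ η ⊤ ≡ η ⊤
    η!∘η = trans (η!∘ (η ⊤)) (trans (cong (η ⊤ ∘_) (!-unique₂ _ id)) identityʳ)

  η!-mass-algebra-morphism : Affine (j ⊤ ⊤ ∘ ⟨ η ⊤ , η ⊤ ⟩) →
                             (η ⊤ ∘ ! μΣ) ∘ ι ≡ mass-algebra ∘ Σ₁ (η ⊤ ∘ ! μΣ)
  η!-mass-algebra-morphism j-affine = begin
    (η ⊤ ∘ ! μΣ) ∘ ι                               ≡⟨ η!∘ ι ⟩
    η ⊤ ∘ ! (Σ₀ μΣ)                                ≡⟨ sym (Affine-bar δΣ (Affine-∘ j-affine (! μΣ))) ⟩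
    mass (Σbar ((j ⊤ ⊤ ∘ ⟨ η ⊤ , η ⊤ ⟩) ∘ ! μΣ))   ≡⟨ cong (λ t → mass (Σbar t)) (sym (pullˡ ⊤-split∘η)) ⟩
    mass (Σbar (⊤-split ∘ η ⊤ ∘ ! μΣ))             ≡⟨ sym (mass-algebra∘Σ₁ (η ⊤ ∘ ! μΣ)) ⟩
    mass-algebra ∘ Σ₁ (η ⊤ ∘ ! μΣ)                 ∎

  module _ (γ : Hom μΣ (T₀ (B₀ μΣ)))
           (γ-model : γ ·ₖ J ι ≡ Bbar (J ι̂) ·ₖ ρ μΣ ·ₖ Σbar (j μΣ (B₀ μΣ) ∘ ⟨ η μΣ , γ ⟩))
           (ρ-affine : ∀ X → Affine (ρ X)) where

    mass-γ-algebra-morphism : mass γ ∘ ι ≡ mass-algebra ∘ Σ₁ (mass γ)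
    mass-γ-algebra-morphism = begin
      mass γ ∘ ι                                    ≡⟨ trans assoc (cong mass (sym (·-η∘ γ ι))) ⟩
      mass (γ ·ₖ J ι)                               ≡⟨ cong mass γ-model ⟩
      mass (Bbar (J ι̂) ·ₖ ρ μΣ ·ₖ Σbar k)           ≡⟨ mass-affine-· (Affine-bar δB (Affine-J ι̂)) _ ⟩
      mass (ρ μΣ ·ₖ Σbar k)                         ≡⟨ mass-affine-· (ρ-affine μΣ) _ ⟩
      mass (Σbar k)                                 ≡⟨ sym (mass-bar-T₁ δΣ (! μΣ ⊕ ! (B₀ μΣ)) k) ⟩
      mass (Σbar (T₁ (! μΣ ⊕ ! (B₀ μΣ)) ∘ k))       ≡⟨ cong (λ t → mass (Σbar t)) (T₁!⊕!∘j∘⟨η,g⟩ γ) ⟩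
      mass (Σbar (⊤-split ∘ mass γ))                ≡⟨ sym (mass-algebra∘Σ₁ (mass γ)) ⟩
      mass-algebra ∘ Σ₁ (mass γ)                    ∎
      where
      k : Hom μΣ (T₀ (μΣ +ₒ B₀ μΣ))
      k = j μΣ (B₀ μΣ) ∘ ⟨ η μΣ , γ ⟩

    model-affine : Affine (j ⊤ ⊤ ∘ ⟨ η ⊤ , η ⊤ ⟩) → Affine γ
    model-affine j-affine = Σ-initial.algebra-morphisms-unique mass-algebra
      mass-γ-algebra-morphism (η!-mass-algebra-morphism j-affine)

  module _ (γ : Hom μΣ (T₀ (B₀ μΣ))) (γ-affine : Affine γ)
           (tr : Hom μΣ (T₀ μB)) (tr-trace : Bbar tr ·ₖ γ ≡ T₁ β⁻¹ ∘ tr) where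

    Ψ-·-trace : ∀ x → Ψ x ·ₖ tr ≡ J β ·ₖ Bbar (x ·ₖ tr) ·ₖ γ
    Ψ-·-trace x = begin
      (J β ·ₖ Bbar x ·ₖ J β⁻¹) ·ₖ tr   ≡⟨ trans (·-assoc _ _ _) (cong (J β ·ₖ_) (·-assoc _ _ _)) ⟩
      J β ·ₖ Bbar x ·ₖ J β⁻¹ ·ₖ tr     ≡⟨ cong (λ t → J β ·ₖ Bbar x ·ₖ t) (trans (η∘-· β⁻¹ tr) (sym tr-trace)) ⟩
      J β ·ₖ Bbar x ·ₖ Bbar tr ·ₖ γ    ≡⟨ cong (J β ·ₖ_) (sym (·-assoc _ _ _)) ⟩
      J β ·ₖ (Bbar x ·ₖ Bbar tr) ·ₖ γ  ≡⟨ cong (λ t → J β ·ₖ t ·ₖ γ) (sym (B-law.bar-· x tr)) ⟩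
      J β ·ₖ Bbar (x ·ₖ tr) ·ₖ γ       ∎

    SubAffine·tr : Hom μB (T₀ μB) → Set h
    SubAffine·tr x = SubAffine (x ·ₖ tr)

    SubAffine·tr-⊥ : SubAffine·tr ⊥
    SubAffine·tr-⊥ = subst SubAffine (sym (⊥-· tr)) SubAffine-⊥

    SubAffine·tr-Ψ : ∀ {x} → SubAffine·tr x → SubAffine·tr (Ψ x)
    SubAffine·tr-Ψ {x} x-subaffine = subst SubAffine (sym (Ψ-·-trace x))
      (SubAffine-affine-· (Affine-J β) (SubAffine-Bbar-· x-subaffine γ-affine))

    SubAffine·tr-⨆ : ∀ {I : Set h} (d : I → Hom μB (T₀ μB)) (dir : Directed d) →
                     (∀ i → SubAffine·tr (d i)) → SubAffine·tr (⨆ d dir)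
    SubAffine·tr-⨆ d dir d-subaffine =
      subst SubAffine (sym (⨆-·ʳ d tr dir)) (SubAffine-⨆ _ (·-directedʳ tr dir) d-subaffine)

    trace-subaffine : SubAffine tr
    trace-subaffine = from-fixpoint
      (Pataraia.fixpoint Ψ Ψ-monotone SubAffine·tr SubAffine·tr-⊥ SubAffine·tr-Ψ SubAffine·tr-⨆)
      where
      from-fixpoint : Σ[ x ∈ Hom μB (T₀ μB) ] (SubAffine·tr x × Ψ x ≡ x) → SubAffine tr
      from-fixpoint (x , x-subaffine , Ψx≡x) = subst SubAffine (·-identityˡ tr)
        (subst SubAffine·tr (Ψ-fixpoint-unique x Ψx≡x) x-subaffine)

proposition29 : ∀ {o h} (S : Setting o h) (L : PreDeSimoneLaw S) →
    let open Setting S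
        open PreDeSimoneLaw L
    in (γ : Hom μΣ (T₀ (B₀ μΣ))) →
       -- γ is the operational model of ρ
       (γ ·ₖ J ι ≡ Bbar (J ι̂) ·ₖ ρ μΣ ·ₖ Σbar (j μΣ (B₀ μΣ) ∘ ⟨ η μΣ , γ ⟩)) →
       (tr : Hom μΣ (T₀ μB)) →
       -- tr is the trace morphism of ρ
       (μ (B₀ μB) ∘ T₁ (δᴮ μB ∘ B₁ tr) ∘ γ ≡ T₁ β⁻¹ ∘ tr) →
       Affine (j ⊤ ⊤ ∘ ⟨ η ⊤ , η ⊤ ⟩) →
       (∀ X → Affine (ρ X)) →
       Affine γ × (T₁ (! μB) ∘ tr ⊑ η ⊤ ∘ ! μΣ)
proposition29 S L γ γ-model tr tr-trace j-affine ρ-affine = γ-affine , trace-subaffine γ γ-affine tr tr-trace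
  where
  open Setting S
  open OperationalModel S L
  γ-affine : Affine γ
  γ-affine = model-affine γ γ-model ρ-affine j-affine
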